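{- For every finite loopless multigraph $G$ and every integer $r\geq 2$, one has $\chi'_r(G)\leq \Delta(G)$, where $\Delta(G)$ is the maximum degree of $G$.
   Context: Multigraphs may have parallel edges but no loops. For a multigraph $G$ and a set $\mathcal C$ of colours, a map $f\colon E(G)\to\mathcal C$ is an $r$-bounded regular colouring if for each $c\in\mathcal C$, every component of the spanning subgraph $G[f^{ -1}(c)]$ (the graph on vertex set $V(G)$ with edge set $f^{ -1}(c)$) is regular of degree at most $r$. The parameter $\chi'_r(G)$ is the smallest number of colours $|\mathcal C|$ for which an $r$-bounded regular colouring of $G$ exists. Degrees count parallel edges with multiplicity. -}

module Defs where

open import Data.Nat using (ℕ; zero; suc; _+_; _≤_; _⊔_)
open import Data.Fin using (Fin; zero; suc) renaming (_≟_ to _≟ᶠ_)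
open import Data.Fin.Properties using ()
open import Data.List using (List; foldr; map)
open import Data.List using () renaming (allFin to allFinL)
open import Data.Product using (_×_; _,_; proj₁; proj₂; Σ; ∃)
open import Data.Sum using (_⊎_)
open import Data.Bool using (Bool; true; false; if_then_else_; _∧_; _∨_)
open import Relation.Nullary using (¬_; does)
open import Relation.Binary.PropositionalEquality using (_≡_; _≢_)

-- A finite loopless multigraph: vertices Fin n, edges Fin m, each edge has an
-- (unordered) pair of distinct endpoints; parallel edges are allowed since
-- distinct edge indices may have the same endpoints.
record Multigraph : Set where
  field
    nV       : ℕ
    nE       : ℕ
    ends     : Fin nE → Fin nV × Fin nV
    loopless : ∀ e → proj₁ (ends e) ≢ proj₂ (ends e)
open Multigraph public

countFin : (k : ℕ) → (Fin k → Bool) → ℕ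
countFin zero    p = 0
countFin (suc k) p = (if p zero then 1 else 0) + countFin k (λ i → p (suc i))

incidentB : (G : Multigraph) → Fin (nE G) → Fin (nV G) → Bool
incidentB G e v = does (proj₁ (ends G e) ≟ᶠ v) ∨ does (proj₂ (ends G e) ≟ᶠ v)

deg : (G : Multigraph) → Fin (nV G) → ℕ
deg G v = countFin (nE G) (λ e → incidentB G e v)

-- maximum degree Δ(G) (0 for the graph with no vertices)
maxDeg : (G : Multigraph) → ℕ
maxDeg G = foldr _⊔_ 0 (map (deg G) (allFinL (nV G)))

Colouring : Multigraph → ℕ → Set
Colouring G k = Fin (nE G) → Fin k

colDeg : (G : Multigraph) {k : ℕ} → Colouring G k → Fin k → Fin (nV G) → ℕ
colDeg G f c v = countFin (nE G) (λ e → does (f e ≟ᶠ c) ∧ incidentB G e v)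

Joins : (G : Multigraph) → Fin (nE G) → Fin (nV G) → Fin (nV G) → Set
Joins G e u w = (proj₁ (ends G e) ≡ u × proj₂ (ends G e) ≡ w)
              ⊎ (proj₁ (ends G e) ≡ w × proj₂ (ends G e) ≡ u)

data Connected (G : Multigraph) {k : ℕ} (f : Colouring G k) (c : Fin k)
     : Fin (nV G) → Fin (nV G) → Set where
  here : ∀ {u} → Connected G f c u u
  step : ∀ {u w v} (e : Fin (nE G)) → f e ≡ c → Joins G e u w →
         Connected G f c w v → Connected G f c u v

-- r-bounded regular colouring: for every colour c, every component of
-- G[f⁻¹(c)] is regular (all its vertices have the same degree) of degree ≤ r
IsBoundedRegular : (G : Multigraph) (r : ℕ) {k : ℕ} → Colouring G k → Set
IsBoundedRegular G r f =
  ∀ c → (∀ v → colDeg G f c v ≤ r)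
      × (∀ u v → Connected G f c u v → colDeg G f c u ≡ colDeg G f c v)

{-# OPTIONS --safe #-}
-- Induction on the maximum degree Δ: it suffices to find a subgraph F whose components are regular of degree at
-- most 2 and which meets every vertex of degree Δ, for F becomes one colour class and G − F has maximum degree Δ − 1.
-- To find F, colour the arcs of the bipartite double cover of G properly with Δ colours (König's theorem, proved
-- with Kempe chains). The arcs of one colour leave and enter every vertex at most once, and every vertex of degree Δ
-- exactly once, so they form directed paths and cycles through all vertices of degree Δ. F consists of the edges of
-- the cycles and of every second arc of each path, starting with the second; it meets all inner vertices of the
-- paths, and each of its components is a single edge or a cycle.

module Submission where

open import Defs
open import Data.Nat using (ℕ; zero; suc; _+_; _≤_; _<_; z≤n; s≤s; _⊔_; _≤′_; ≤′-refl; ≤′-step; _≤?_)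
  renaming (_≟_ to _≟ℕ_)
open import Data.Nat.Properties
  using (≤-trans; ≤-refl; ≤-antisym; ≤-pred; 1+n≰n; n≤1+n; n<1+n; m≤n+m; +-assoc; +-suc; +-comm; suc-injective;
         +-monoˡ-≤; +-cancelˡ-≤; ≤∧≢⇒<; m≤n⇒m≤1+n; <⇒≢; ≤⇒≤′; ≰⇒>; m≤m⊔n; m≤n⇒m≤o⊔n; anyUpTo?;
         module ≤-Reasoning)
open import Data.Fin using (Fin; zero; suc; toℕ; fromℕ<; splitAt; join; _↑ˡ_; _↑ʳ_) renaming (_≟_ to _≟ᶠ_)
open import Data.Fin.Properties
  using (any?; all?; ¬∀⟶∃¬; pigeonhole; toℕ≤pred[n]; toℕ-fromℕ<; toℕ-injective; 0≢1+n;
         splitAt-↑ˡ; splitAt-↑ʳ; splitAt-join; join-splitAt)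
  renaming (suc-injective to fin-suc-injective)
open import Data.Fin.Permutation.Components using (transpose; transpose-inverse)
open import Data.Bool using (Bool; true; false; T; T?; not; _∧_; _∨_; if_then_else_)
open import Data.Bool.Properties using (T-∧; T-∨; ∧-identityʳ; ∧-commutativeMonoid)
open import Algebra.Bundles using (CommutativeMonoid)
open import Algebra.Properties.CommutativeSemigroup (CommutativeMonoid.commutativeSemigroup ∧-commutativeMonoid)
  using () renaming (xy∙z≈xz∙y to ∧-swap)
open import Data.Maybe using (Maybe; just; nothing; _>>=_; maybe)
import Data.Maybe as Maybe
import Data.Maybe.Properties as Maybe
open import Data.Product using (_×_; _,_; ∃; Σ; proj₁; proj₂; swap)
open import Data.Sum using (_⊎_; inj₁; inj₂; reduce; [_,_])
import Data.Sum as Sum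
open import Data.Unit using (tt)
open import Data.List using (List; _∷_; foldr)
open import Data.List.Relation.Unary.Any using (here; there)
open import Data.List.Membership.Propositional using (_∈_)
open import Data.List.Membership.Propositional.Properties using (∈-map⁺; ∈-allFin)
open import Function using (id; _∘_; const; Equivalence; mk⇔)
open import Relation.Nullary using (¬_; Dec; does; yes; no)
open import Relation.Nullary.Decidable using (map′; _×-dec_; dec-true; dec-false; does-⇔)
open import Relation.Nullary.Negation using (contradiction)
open import Relation.Binary using (DecidableEquality)
open import Relation.Binary.PropositionalEquality hiding ([_])

private variable k l : ℕ

BoolPred : ℕ → Set
BoolPred k = Fin k → Bool

_⊆_ : BoolPred k → BoolPred k → Set
p ⊆ q = ∀ {i} → T (p i) → T (q i)

does⁺ : ∀ {P : Set} (d : Dec P) → P → T (does d)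
does⁺ (yes _)  _ = tt
does⁺ (no ¬p) p = ¬p p

does⁻ : ∀ {P : Set} (d : Dec P) → T (does d) → P
does⁻ (yes p) _ = p

delete : Fin k → BoolPred k → BoolPred k
delete i p j = p j ∧ not (does (j ≟ᶠ i))

_∖_ : BoolPred k → BoolPred k → BoolPred k
(S ∖ F) e = S e ∧ not (F e)

countFin-cong : (p q : BoolPred k) → (∀ i → p i ≡ q i) → countFin k p ≡ countFin k q
countFin-cong {zero}  p q eq = refl
countFin-cong {suc k} p q eq rewrite eq zero = cong (_ +_) (countFin-cong _ _ (λ i → eq (suc i)))

countFin-true : ∀ k → countFin k (const true) ≡ k
countFin-true zero    = refl
countFin-true (suc k) = cong suc (countFin-true k)

countFin-delete : (p : BoolPred k) (i : Fin k) → T (p i) → countFin k p ≡ suc (countFin k (delete i p))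
countFin-delete {suc k} p zero pi with p zero
... | true = cong suc (countFin-cong _ _ (λ j → sym (∧-identityʳ (p (suc j)))))
countFin-delete {suc k} p (suc i) pi with p zero
... | true  = cong suc (countFin-delete (λ j → p (suc j)) i pi)
... | false = countFin-delete (λ j → p (suc j)) i pi

T⇒1≤countFin : (p : BoolPred k) (i : Fin k) → T (p i) → 1 ≤ countFin k p
T⇒1≤countFin p i pi rewrite countFin-delete p i pi = s≤s z≤n

1≤countFin⇒T : (p : BoolPred k) → 1 ≤ countFin k p → ∃ λ i → T (p i)
1≤countFin⇒T {suc k} p pos with p zero in eq
... | true  = zero , subst T (sym eq) tt
... | false with 1≤countFin⇒T (λ i → p (suc i)) pos
...   | i , pi = suc i , pi

T-delete : (p : BoolPred k) {i j : Fin k} → T (p j) → j ≢ i → T (delete i p j)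
T-delete p {i} {j} pj j≢i with p j | j ≟ᶠ i
... | true | no _    = tt
... | true | yes j≡i = contradiction j≡i j≢i

delete⊆ : (p : BoolPred k) (i : Fin k) → delete i p ⊆ p
delete⊆ p i h = proj₁ (Equivalence.to T-∧ h)

countFin-injective⇒≤ : (p : BoolPred k) (q : BoolPred l) (g : Fin k → Fin l) →
  (∀ {i} → T (p i) → T (q (g i))) →
  (∀ {i j} → T (p i) → T (p j) → g i ≡ g j → i ≡ j) →
  countFin k p ≤ countFin l q
countFin-injective⇒≤ {zero}  p q g maps inj = z≤n
countFin-injective⇒≤ {suc k} p q g maps inj with p zero in eq
... | false = countFin-injective⇒≤ (λ i → p (suc i)) q (λ i → g (suc i)) maps
                (λ pi pj e → fin-suc-injective (inj pi pj e))
... | true = subst (suc _ ≤_) (sym (countFin-delete q (g zero) (maps p0)))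
               (s≤s (countFin-injective⇒≤ (λ i → p (suc i)) (delete (g zero) q) (λ i → g (suc i))
                 (λ pi → T-delete q (maps pi) (λ e → 0≢1+n (sym (inj pi p0 e))))
                 (λ pi pj e → fin-suc-injective (inj pi pj e))))
  where p0 : T (p zero)
        p0 = subst T (sym eq) tt

countFin-mono : (p q : BoolPred k) → p ⊆ q → countFin k p ≤ countFin k q
countFin-mono p q p⊆q = countFin-injective⇒≤ p q (λ i → i) p⊆q (λ _ _ e → e)

countFin≤1 : (p : BoolPred k) (i : Fin k) → (∀ {j} → T (p j) → j ≡ i) → countFin k p ≤ 1
countFin≤1 p i only-i = subst (countFin _ p ≤_) (countFin-true 1)
  (countFin-injective⇒≤ p (const true) (λ _ → zero {n = 0}) (const tt)
    (λ pj pj′ _ → trans (only-i pj) (sym (only-i pj′))))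

countFin≤2 : (p : BoolPred k) (i i′ : Maybe (Fin k)) → (∀ {j} → T (p j) → i ≡ just j ⊎ i′ ≡ just j) →
             countFin k p ≤ 2
countFin≤2 p i i′ only = subst (countFin _ p ≤_) (countFin-true 2)
  (countFin-injective⇒≤ p (const true) which (const tt) which-injective)
  where
  which : Fin _ → Fin 2
  which j = if does (Maybe.≡-dec _≟ᶠ_ i (just j)) then zero else suc zero
  which-injective : ∀ {j j′} → T (p j) → T (p j′) → which j ≡ which j′ → j ≡ j′
  which-injective {j} {j′} pj pj′ e
    with Maybe.≡-dec _≟ᶠ_ i (just j) | Maybe.≡-dec _≟ᶠ_ i (just j′) | only pj | only pj′
  ... | yes i≡j | yes i≡j′ | _ | _ = Maybe.just-injective (trans (sym i≡j) i≡j′)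
  ... | no i≢j  | _        | inj₁ i≡j  | _          = contradiction i≡j i≢j
  ... | _       | no i≢j′  | _         | inj₁ i≡j′  = contradiction i≡j′ i≢j′
  ... | no _    | no _     | inj₂ i′≡j | inj₂ i′≡j′ = Maybe.just-injective (trans (sym i′≡j) i′≡j′)

2≤countFin : (p : BoolPred k) {i i′ : Fin k} → i ≢ i′ → T (p i) → T (p i′) → 2 ≤ countFin k p
2≤countFin p {i} {i′} i≢i′ pi pi′ = subst (_≤ countFin _ p) (countFin-true 2)
  (countFin-injective⇒≤ (const true) p pick pick-in pick-injective)
  where
  pick : Fin 2 → Fin _
  pick zero       = i
  pick (suc zero) = i′
  pick-in : ∀ {j} → T true → T (p (pick j))
  pick-in {zero}     _ = pi
  pick-in {suc zero} _ = pi′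
  pick-injective : ∀ {j j′} → T true → T true → pick j ≡ pick j′ → j ≡ j′
  pick-injective {zero}     {zero}     _ _ _ = refl
  pick-injective {zero}     {suc zero} _ _ e = contradiction e i≢i′
  pick-injective {suc zero} {zero}     _ _ e = contradiction (sym e) i≢i′
  pick-injective {suc zero} {suc zero} _ _ _ = refl

countFin-split : (p q : BoolPred k) →
  countFin k p ≡ countFin k (λ i → p i ∧ q i) + countFin k (λ i → p i ∧ not (q i))
countFin-split {zero}  p q = refl
countFin-split {suc k} p q with p zero | q zero
... | false | _     = countFin-split (λ i → p (suc i)) (λ i → q (suc i))
... | true  | true  = cong suc (countFin-split (λ i → p (suc i)) (λ i → q (suc i)))
... | true  | false = trans (cong suc (countFin-split (λ i → p (suc i)) (λ i → q (suc i))))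
                            (sym (+-suc _ _))

countFin-++ : ∀ k l (p : BoolPred (k + l)) →
  countFin (k + l) p ≡ countFin k (λ i → p (i ↑ˡ l)) + countFin l (λ j → p (k ↑ʳ j))
countFin-++ zero    l p = refl
countFin-++ (suc k) l p = trans (cong ((if p zero then 1 else 0) +_) (countFin-++ k l (λ i → p (suc i))))
                                (sym (+-assoc (if p zero then 1 else 0) _ _))

odd : ℕ → Bool
odd zero    = false
odd (suc n) = not (odd n)

module PartialInjection
  {V : Set} {N : ℕ} (index : V → Fin N) (index-injective : ∀ {x y} → index x ≡ index y → x ≡ y)
  (step : V → Maybe V) (step-injective : ∀ {x x′ y} → step x ≡ just y → step x′ ≡ just y → x ≡ x′)
  where

  _≟_ : DecidableEquality V
  x ≟ y = map′ index-injective (cong index) (index x ≟ᶠ index y)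

  iterate : ℕ → V → Maybe V
  iterate zero    x = just x
  iterate (suc k) x = step x >>= iterate k

  iterate-suc : ∀ k x → iterate (suc k) x ≡ (iterate k x >>= step)
  iterate-suc zero    x with step x
  ... | just _  = refl
  ... | nothing = refl
  iterate-suc (suc k) x with step x
  ... | just y  = iterate-suc k y
  ... | nothing = refl

  iterate-suc-just : ∀ k x {w} → iterate (suc k) x ≡ just w → ∃ λ u → iterate k x ≡ just u × step u ≡ just w
  iterate-suc-just k x h with iterate k x | iterate-suc k x
  ... | just u  | eq = u , refl , trans (sym eq) h
  ... | nothing | eq = contradiction (trans (sym h) eq) λ ()

  iterate-nothing-suc : ∀ k x → iterate k x ≡ nothing → iterate (suc k) x ≡ nothing
  iterate-nothing-suc k x h rewrite iterate-suc k x | h = refl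

  iterate-nothing-mono : ∀ {k j} x → k ≤ j → iterate k x ≡ nothing → iterate j x ≡ nothing
  iterate-nothing-mono {k} x k≤j h = go (≤⇒≤′ k≤j)
    where
    go : ∀ {j} → k ≤′ j → iterate j x ≡ nothing
    go ≤′-refl         = h
    go (≤′-step {j} p) = iterate-nothing-suc j x (go p)

  iterate-just⇒< : ∀ {k x v} → iterate N x ≡ nothing → iterate k x ≡ just v → k < N
  iterate-just⇒< {k} {x} end h with N ≤? k
  ... | yes N≤k = contradiction (trans (sym h) (iterate-nothing-mono x N≤k end)) λ ()
  ... | no  N≰k = ≰⇒> N≰k

  Cyclic : V → Set
  Cyclic x = ∃ λ k → k < N × iterate (suc k) x ≡ just x

  cyclic? : ∀ x → Dec (Cyclic x)
  cyclic? x = anyUpTo? (λ k → Maybe.≡-dec _≟_ (iterate (suc k) x) (just x)) N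

  cyclic-step : ∀ {x y} → step x ≡ just y → Cyclic x → Cyclic y
  cyclic-step {x} {y} x↦y (k , k<N , h) = k , k<N , (begin
    iterate (suc k) y      ≡⟨ iterate-suc k y ⟩
    (iterate k y >>= step) ≡⟨ cong (_>>= step) (trans (sym (cong (_>>= iterate k) x↦y)) h) ⟩
    step x                 ≡⟨ x↦y ⟩
    just y                 ∎)
    where open ≡-Reasoning

  cyclic-step⁻ : ∀ {x y} → step x ≡ just y → Cyclic y → Cyclic x
  cyclic-step⁻ {x} {y} x↦y (k , k<N , h) with iterate-suc-just k y h
  ... | u , y↝u , u↦y = k , k<N , (begin
    iterate (suc k) x ≡⟨ cong (_>>= iterate k) x↦y ⟩
    iterate k y       ≡⟨ y↝u ⟩
    just u            ≡⟨ cong just (step-injective u↦y x↦y) ⟩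
    just x            ∎)
    where open ≡-Reasoning

  cyclic⇒stepped : ∀ {x} → Cyclic x → ∃ λ y → step x ≡ just y
  cyclic⇒stepped {x} (k , _ , h) with step x
  ... | just y = y , refl

  cyclic⇒entered : ∀ {x} → Cyclic x → ∃ λ u → step u ≡ just x
  cyclic⇒entered {x} (k , _ , h) with iterate-suc-just k x h
  ... | u , _ , u↦x = u , u↦x

  private
    repeat⇒cyclic : ∀ {x w} i j → i < j → j ≤ N → iterate i x ≡ just w → iterate j x ≡ just w → Cyclic x
    repeat⇒cyclic zero    (suc j) _ j<N refl h = j , j<N , h
    repeat⇒cyclic {x} (suc i) (suc j) (s≤s i<j) j<N hi hj
      with iterate-suc-just i x hi | iterate-suc-just j x hj
    ... | u , x↝u , u↦w | u′ , x↝u′ , u′↦w =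
      repeat⇒cyclic i j i<j (≤-trans (n≤1+n j) j<N) x↝u
        (trans x↝u′ (cong just (step-injective u′↦w u↦w)))

    visited : ∀ {x v} k → k ≤ N → iterate N x ≡ just v → ∃ λ u → iterate k x ≡ just u
    visited {x} k k≤N end with iterate k x in eq
    ... | just u  = u , refl
    ... | nothing = contradiction (trans (sym end) (iterate-nothing-mono x k≤N eq)) λ ()

  -- The walk visits N + 1 vertices, so it repeats one; injectivity of step moves the repetition back to x.
  long-walk⇒cyclic : ∀ {x v} → iterate N x ≡ just v → Cyclic x
  long-walk⇒cyclic {x} end =
    repeat⇒cyclic (toℕ i) (toℕ j) i<j (toℕ≤pred[n] j) (proj₂ (visit i))
      (trans (proj₂ (visit j)) (cong just (index-injective (sym same))))
    where
    visit : (i : Fin (suc N)) → ∃ λ u → iterate (toℕ i) x ≡ just u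
    visit i = visited (toℕ i) (toℕ≤pred[n] i) end
    repeat = pigeonhole (n<1+n N) (λ i → index (proj₁ (visit i)))
    i = proj₁ repeat
    j = proj₁ (proj₂ repeat)
    i<j = proj₁ (proj₂ (proj₂ repeat))
    same = proj₂ (proj₂ (proj₂ repeat))

  acyclic⇒terminates : ∀ {x} → ¬ Cyclic x → iterate N x ≡ nothing
  acyclic⇒terminates {x} acyclic with iterate N x in end
  ... | nothing = refl
  ... | just v  = contradiction (long-walk⇒cyclic end) acyclic

  depthWithin : ℕ → V → ℕ
  depthWithin zero    x = 0
  depthWithin (suc k) x = maybe (λ y → suc (depthWithin k y)) 0 (step x)

  depthWithin-stable : ∀ {k j} x → k ≤ j → iterate k x ≡ nothing → depthWithin k x ≡ depthWithin j x
  depthWithin-stable {suc k} {suc j} x (s≤s k≤j) end with step x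
  ... | nothing = refl
  ... | just y  = cong suc (depthWithin-stable y k≤j end)

  depth : V → ℕ
  depth = depthWithin N

  depth-step : ∀ {x y} → step x ≡ just y → ¬ Cyclic x → depth x ≡ suc (depth y)
  depth-step {x} {y} x↦y acyclic = go N (acyclic⇒terminates acyclic)
    where
    go : ∀ k → iterate k x ≡ nothing → depthWithin k x ≡ suc (depthWithin k y)
    go (suc k) end rewrite x↦y = cong suc (depthWithin-stable y (n≤1+n k) end)

  alternating : V → Bool
  alternating x = does (cyclic? x) ∨ odd (depth x)

  cyclic⇒alternating : ∀ {x} → Cyclic x → T (alternating x)
  cyclic⇒alternating {x} cyc with cyclic? x
  ... | yes _  = _
  ... | no acyc = contradiction cyc acyc

  alternating-step : ∀ {x y} → step x ≡ just y → ¬ Cyclic x → alternating x ≡ not (alternating y)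
  alternating-step {x} {y} x↦y acyclic with cyclic? x | cyclic? y
  ... | yes cyc | _       = contradiction cyc acyclic
  ... | no _    | yes cyc = contradiction (cyclic-step⁻ x↦y cyc) acyclic
  ... | no _    | no _    = cong odd (depth-step x↦y acyclic)

  alternating-step⁺ : ∀ {x y} → step x ≡ just y → ¬ Cyclic x → T (alternating x) → ¬ T (alternating y)
  alternating-step⁺ {x} {y} x↦y acyclic ax ay with alternating y | alternating-step x↦y acyclic
  ... | true | eq = subst T eq ax

  alternating-step⁻ : ∀ {x y} → step x ≡ just y → ¬ Cyclic x → ¬ T (alternating x) → T (alternating y)
  alternating-step⁻ {x} {y} x↦y acyclic ¬ax with alternating y | alternating-step x↦y acyclic
  ... | true  | _  = _
  ... | false | eq = ¬ax (subst T (sym eq) _)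

transpose-α : ∀ {K} (α β : Fin K) → transpose α β α ≡ β
transpose-α α β rewrite dec-true (α ≟ᶠ α) refl = refl

transpose-β : ∀ {K} (α β : Fin K) → transpose α β β ≡ α
transpose-β α β with β ≟ᶠ α
... | yes β≡α = β≡α
... | no _ rewrite dec-true (β ≟ᶠ β) refl = refl

module Bipartite {M A B : ℕ} (left : Fin M → Fin A) (right : Fin M → Fin B) where

  Vertex : Set
  Vertex = Fin A ⊎ Fin B

  Incident : Fin M → Vertex → Set
  Incident e (inj₁ x) = left e ≡ x
  Incident e (inj₂ y) = right e ≡ y

  incident? : ∀ e v → Dec (Incident e v)
  incident? e (inj₁ x) = left e ≟ᶠ x
  incident? e (inj₂ y) = right e ≟ᶠ y

  degree : BoolPred M → Vertex → ℕ
  degree P v = countFin M (λ e → P e ∧ does (incident? e v))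

  at-intro : ∀ (P : BoolPred M) v {e} → T (P e) → Incident e v → T (P e ∧ does (incident? e v))
  at-intro P v {e} pe inc = Equivalence.from T-∧ (pe , does⁺ (incident? e v) inc)

  at-elim : ∀ (P : BoolPred M) v {e} → T (P e ∧ does (incident? e v)) → T (P e) × Incident e v
  at-elim P v {e} h with Equivalence.to T-∧ h
  ... | pe , inc = pe , does⁻ (incident? e v) inc

  degree-mono : ∀ {Q P} → Q ⊆ P → ∀ v → degree Q v ≤ degree P v
  degree-mono {Q} {P} Q⊆P v = countFin-mono _ _ λ {e} h →
    let (qe , inc) = at-elim Q v {e} h in at-intro P v (Q⊆P qe) inc

  degree-delete : ∀ {P e₀ v} → T (P e₀) → Incident e₀ v → degree P v ≡ suc (degree (delete e₀ P) v)
  degree-delete {P} {e₀} {v} pe₀ inc = trans (countFin-delete _ e₀ (at-intro P v pe₀ inc))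
    (cong suc (countFin-cong _ _ λ e → ∧-swap (P e) (does (incident? e v)) _))

  module _ {K : ℕ} where

    Proper : BoolPred M → (Fin M → Fin K) → Set
    Proper P col = ∀ {v e e′} → T (P e) → T (P e′) → Incident e v → Incident e′ v →
                   col e ≡ col e′ → e ≡ e′

    Misses : BoolPred M → (Fin M → Fin K) → Vertex → Fin K → Set
    Misses P col v c = ∀ {e} → T (P e) → Incident e v → col e ≢ c

    Present : BoolPred M → (Fin M → Fin K) → Vertex → Fin K → Set
    Present P col v c = ∃ λ e → T (P e) × Incident e v × col e ≡ c

    present? : ∀ P col v c → Dec (Present P col v c)
    present? P col v c = any? (λ e → T? (P e) ×-dec incident? e v ×-dec col e ≟ᶠ c)

    missing-colour : ∀ {P col v} → Proper P col → degree P v < K → ∃ (Misses P col v)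
    missing-colour {P} {col} {v} proper deg<K with all? (present? P col v)
    ... | yes all-present = contradiction (≤-trans deg<K K≤deg) 1+n≰n
      where
      K≤deg : K ≤ degree P v
      K≤deg = subst (_≤ degree P v) (countFin-true K)
        (countFin-injective⇒≤ (const true) _ (λ c → proj₁ (all-present c))
          (λ {c} _ → let (_ , pe , inc , _) = all-present c in at-intro P v pe inc)
          (λ {c} {c′} _ _ same → let (_ , _ , _ , col≡c) = all-present c
                                     (_ , _ , _ , col≡c′) = all-present c′
                                 in trans (sym col≡c) (trans (cong col same) col≡c′)))
    ... | no some-absent with ¬∀⟶∃¬ K _ (present? P col v) some-absent
    ...   | c , absent = c , λ pe inc col≡c → absent (_ , pe , inc , col≡c)

    misses⇒degree< : ∀ {P col v c} → Proper P col → Misses P col v c → degree P v < K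
    misses⇒degree< {P} {col} {v} {c} proper misses = subst (suc (degree P v) ≤_) (sym K≡1+[K-1]) (s≤s deg≤K-1)
      where
      K-1 = countFin K (delete c (const true))
      K≡1+[K-1] : K ≡ suc K-1
      K≡1+[K-1] = trans (sym (countFin-true K)) (countFin-delete (const true) c _)
      deg≤K-1 : degree P v ≤ K-1
      deg≤K-1 = countFin-injective⇒≤ _ _ col
        (λ h → let (pe , inc) = at-elim P v h in T-delete (const true) _ (misses pe inc))
        (λ h h′ same → let (pe , inc) = at-elim P v h ; (pe′ , inc′) = at-elim P v h′
                       in proper pe pe′ inc inc′ same)

    present-colour : ∀ {P col v} → Proper P col → degree P v ≡ K → ∀ c → Present P col v c
    present-colour {P} {col} {v} proper deg≡K c with present? P col v c
    ... | yes present = present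
    ... | no absent   = contradiction deg≡K (<⇒≢ (misses⇒degree< proper λ pe inc col≡c → absent (_ , pe , inc , col≡c)))

    -- The chain from b leaves right vertices along α and left vertices along β. It never enters a, which misses α,
    -- nor returns to b, which misses β; so swapping α and β along it makes α missing at both a and b.
    module KempeChain {P : BoolPred M} {col : Fin M → Fin K} (proper : Proper P col)
      {α β : Fin K} {a : Fin A} {b : Fin B}
      (a-misses-α : Misses P col (inj₁ a) α) (b-misses-β : Misses P col (inj₂ b) β) where

      follow arrive : Vertex → Fin K
      follow (inj₁ _) = β
      follow (inj₂ _) = α
      arrive (inj₁ _) = α
      arrive (inj₂ _) = β

      opposite : Vertex → Fin M → Vertex
      opposite (inj₁ _) e = inj₂ (right e)
      opposite (inj₂ _) e = inj₁ (left e)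

      opposite-incident : ∀ v e → Incident e (opposite v e)
      opposite-incident (inj₁ _) e = refl
      opposite-incident (inj₂ _) e = refl

      opposite-opposite : ∀ {e} v → Incident e v → opposite (opposite v e) e ≡ v
      opposite-opposite (inj₁ _) refl = refl
      opposite-opposite (inj₂ _) refl = refl

      follow-opposite : ∀ v e → follow v ≡ arrive (opposite v e)
      follow-opposite (inj₁ _) e = refl
      follow-opposite (inj₂ _) e = refl

      incident-ends : ∀ {e} u v → Incident e u → Incident e v → v ≡ u ⊎ v ≡ opposite u e
      incident-ends (inj₁ _) (inj₁ _) refl refl = inj₁ refl
      incident-ends (inj₁ _) (inj₂ _) refl refl = inj₂ refl
      incident-ends (inj₂ _) (inj₁ _) refl refl = inj₂ refl
      incident-ends (inj₂ _) (inj₂ _) refl refl = inj₁ refl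

      Leaves : Fin M → Vertex → Set
      Leaves e v = T (P e) × Incident e v × col e ≡ follow v

      leaves? : ∀ e v → Dec (Leaves e v)
      leaves? e v = T? (P e) ×-dec incident? e v ×-dec col e ≟ᶠ follow v

      leaves-unique : ∀ {e e′ v} → Leaves e v → Leaves e′ v → e ≡ e′
      leaves-unique (pe , inc , c) (pe′ , inc′ , c′) = proper pe pe′ inc inc′ (trans c (sym c′))

      exit : Vertex → Maybe (Fin M)
      exit v with any? (λ e → leaves? e v)
      ... | yes (e , _) = just e
      ... | no _        = nothing

      exit-leaves : ∀ {v e} → exit v ≡ just e → Leaves e v
      exit-leaves {v} h with any? (λ e → leaves? e v)
      exit-leaves refl | yes (_ , leaves) = leaves

      leaves-exit : ∀ {v e} → Leaves e v → exit v ≡ just e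
      leaves-exit {v} leaves with any? (λ e → leaves? e v)
      ... | yes (_ , leaves′) = cong just (leaves-unique leaves′ leaves)
      ... | no none           = contradiction (_ , leaves) none

      next : Vertex → Maybe Vertex
      next v = Maybe.map (opposite v) (exit v)

      next-just : ∀ {v w} → next v ≡ just w → ∃ λ e → Leaves e v × w ≡ opposite v e
      next-just {v} h with exit v in eq
      next-just refl | just e = e , exit-leaves eq , refl

      leaves-next : ∀ {v e} → Leaves e v → next v ≡ just (opposite v e)
      leaves-next {v} leaves rewrite leaves-exit leaves = refl

      next-enters : ∀ {v w} → next v ≡ just w → ∃ λ e → Leaves e v × Incident e w × col e ≡ arrive w
      next-enters {v} h with next-just h
      ... | e , leaves@(_ , _ , c) , refl = e , leaves , opposite-incident v e , trans c (follow-opposite v e)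

      next-injective : ∀ {u u′ w} → next u ≡ just w → next u′ ≡ just w → u ≡ u′
      next-injective {u} {u′} h h′ with next-just h | next-just h′
      ... | e , (pe , inc , c) , refl | e′ , (pe′ , inc′ , c′) , w≡ = begin
        u                             ≡⟨ opposite-opposite u inc ⟨
        opposite (opposite u e) e     ≡⟨ cong₂ opposite w≡ e≡e′ ⟩
        opposite (opposite u′ e′) e′  ≡⟨ opposite-opposite u′ inc′ ⟩
        u′                            ∎
        where
        open ≡-Reasoning
        e≡e′ : e ≡ e′
        e≡e′ = proper pe pe′ (opposite-incident u e)
          (subst (Incident e′) (sym w≡) (opposite-incident u′ e′))
          (trans c (trans (follow-opposite u e)
            (trans (cong arrive w≡) (sym (trans c′ (follow-opposite u′ e′))))))

      index-injective : ∀ {v w} → join A B v ≡ join A B w → v ≡ w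
      index-injective {v} {w} same = begin
        v                         ≡⟨ splitAt-join A B v ⟨
        splitAt A (join A B v)    ≡⟨ cong (splitAt A) same ⟩
        splitAt A (join A B w)    ≡⟨ splitAt-join A B w ⟩
        w                         ∎
        where open ≡-Reasoning

      open PartialInjection (join A B) index-injective next next-injective

      start : Vertex
      start = inj₂ b

      start-acyclic : ¬ Cyclic start
      start-acyclic cyc = let (_ , u↦b) = cyclic⇒entered cyc
                              (_ , (pe , _ , _) , inc , c) = next-enters u↦b
                          in b-misses-β pe inc c

      OnChain : Fin M → Set
      OnChain e = ∃ λ k → ∃ λ v → iterate k start ≡ just v × Leaves e v

      onChain? : ∀ e → Dec (OnChain e)
      onChain? e = map′ (λ (k , _ , on) → k , on)
                        (λ (k , on@(v , h , _)) → k , iterate-just⇒< (acyclic⇒terminates start-acyclic) h , on)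
                        (anyUpTo? (λ k → leavesFrom? (iterate k start)) (A + B))
        where
        leavesFrom? : ∀ mv → Dec (∃ λ v → mv ≡ just v × Leaves e v)
        leavesFrom? nothing  = no λ ()
        leavesFrom? (just v) = map′ (λ l → v , refl , l) (λ { (_ , refl , l) → l }) (leaves? e v)

      chain-vertex : ∀ {e v} → OnChain e → Incident e v → ∃ λ k → iterate k start ≡ just v
      chain-vertex {e} {v} (k , u , hk , leaves@(_ , inc-u , _)) inc-v with incident-ends u v inc-u inc-v
      ... | inj₁ refl = k , hk
      ... | inj₂ refl = suc k , (begin
        iterate (suc k) start       ≡⟨ iterate-suc k start ⟩
        (iterate k start >>= next)  ≡⟨ cong (_>>= next) hk ⟩
        next u                      ≡⟨ leaves-next leaves ⟩
        just (opposite u e)         ∎)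
        where open ≡-Reasoning

      entered : ∀ {k v} → iterate k start ≡ just v →
                v ≡ start ⊎ ∃ λ e → OnChain e × Incident e v × col e ≡ arrive v
      entered {zero}  refl = inj₁ refl
      entered {suc k} h with iterate-suc-just k start h
      ... | u , hk , u↦v with next-enters u↦v
      ...   | e , leaves , inc , c = inj₂ (e , (k , u , hk , leaves) , inc , c)

      chain-closed : ∀ {e e′ v} → OnChain e → Incident e v → T (P e′) → Incident e′ v →
                     col e′ ≡ follow v ⊎ col e′ ≡ arrive v → OnChain e′
      chain-closed on inc pe′ inc′ (inj₁ c) with chain-vertex on inc
      ... | k , hk = k , _ , hk , pe′ , inc′ , c
      chain-closed {v = v} on inc pe′ inc′ (inj₂ c) with chain-vertex on inc
      ... | k , hk with entered {k} hk
      ...   | inj₁ refl = contradiction c (b-misses-β pe′ inc′)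
      ...   | inj₂ (e″ , on″@(_ , _ , _ , pe″ , _) , inc″ , c″) =
              subst OnChain (sym (proper pe′ pe″ inc′ inc″ (trans c (sym c″)))) on″

      chain-colour : ∀ {e v} → OnChain e → Incident e v → col e ≡ follow v ⊎ col e ≡ arrive v
      chain-colour {e} {v} (_ , u , _ , _ , inc-u , c) inc-v with incident-ends u v inc-u inc-v
      ... | inj₁ refl = inj₁ c
      ... | inj₂ refl = inj₂ (trans c (follow-opposite u e))

      chain-avoids-a : ∀ {e} → OnChain e → ¬ Incident e (inj₁ a)
      chain-avoids-a on inc with chain-vertex on inc
      ... | k , hk with entered {k} hk
      ...   | inj₂ (_ , (_ , _ , _ , pe , _) , inc′ , c) = a-misses-α pe inc′ c

      transpose-follow : ∀ v → transpose α β (follow v) ≡ arrive v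
      transpose-follow (inj₁ _) = transpose-β α β
      transpose-follow (inj₂ _) = transpose-α α β

      transpose-arrive : ∀ v → transpose α β (arrive v) ≡ follow v
      transpose-arrive (inj₁ _) = transpose-α α β
      transpose-arrive (inj₂ _) = transpose-β α β

      recoloured : Fin M → Fin K
      recoloured e with onChain? e
      ... | yes _ = transpose α β (col e)
      ... | no _  = col e

      off-chain-colour : ∀ {e e′ v} → OnChain e → Incident e v → T (P e′) → Incident e′ v → ¬ OnChain e′ →
                         col e′ ≢ transpose α β (col e)
      off-chain-colour {e} {e′} {v} on inc pe′ inc′ off c′ = off (chain-closed on inc pe′ inc′ swapped)
        where
        swapped : col e′ ≡ follow v ⊎ col e′ ≡ arrive v
        swapped with chain-colour on inc
        ... | inj₁ c = inj₂ (trans c′ (trans (cong (transpose α β) c) (transpose-follow v)))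
        ... | inj₂ c = inj₁ (trans c′ (trans (cong (transpose α β) c) (transpose-arrive v)))

      recoloured-proper : Proper P recoloured
      recoloured-proper {v} {e} {e′} pe pe′ inc inc′ same with onChain? e | onChain? e′
      ... | yes _  | yes _   = proper pe pe′ inc inc′
              (trans (sym (transpose-inverse β α)) (trans (cong (transpose β α) same) (transpose-inverse β α)))
      ... | no _   | no _    = proper pe pe′ inc inc′ same
      ... | yes on | no off′ = contradiction (sym same) (off-chain-colour on inc pe′ inc′ off′)
      ... | no off | yes on′ = contradiction same (off-chain-colour on′ inc′ pe inc off)

      recoloured-misses-a : Misses P recoloured (inj₁ a) α
      recoloured-misses-a {e} pe inc with onChain? e
      ... | yes on = contradiction inc (chain-avoids-a on)
      ... | no _   = a-misses-α pe inc

      recoloured-misses-b : Misses P recoloured (inj₂ b) α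
      recoloured-misses-b {e} pe inc with onChain? e
      ... | no off = λ c → off (0 , start , refl , pe , inc , c)
      ... | yes on with chain-colour on inc
      ...   | inj₂ c = λ _ → b-misses-β pe inc c
      ...   | inj₁ c≡α = λ c′≡α → b-misses-β pe inc (begin
        col e                  ≡⟨ c≡α ⟩
        α                      ≡⟨ c′≡α ⟨
        transpose α β (col e)  ≡⟨ cong (transpose α β) c≡α ⟩
        transpose α β α        ≡⟨ transpose-α α β ⟩
        β                      ∎)
        where open ≡-Reasoning

    assign : Fin M → Fin K → (Fin M → Fin K) → Fin M → Fin K
    assign e₀ γ col e with e ≟ᶠ e₀
    ... | yes _ = γ
    ... | no _  = col e

    extend : ∀ {P e₀ col γ} → Proper (delete e₀ P) col →
             (∀ {v} → Incident e₀ v → Misses (delete e₀ P) col v γ) → Proper P (assign e₀ γ col)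
    extend {P} {e₀} {col} {γ} proper misses {v} {e} {e′} pe pe′ inc inc′ same with e ≟ᶠ e₀ | e′ ≟ᶠ e₀
    ... | yes refl | yes refl = refl
    ... | yes refl | no e′≢e₀ = contradiction (sym same) (misses inc (T-delete P pe′ e′≢e₀) inc′)
    ... | no e≢e₀  | yes refl = contradiction same (misses inc′ (T-delete P pe e≢e₀) inc)
    ... | no e≢e₀  | no e′≢e₀ = proper (T-delete P pe e≢e₀) (T-delete P pe′ e′≢e₀) inc inc′ same

    insert-edge : ∀ {P e₀ col} → T (P e₀) → (∀ {v} → Incident e₀ v → degree P v ≤ K) →
                  Proper (delete e₀ P) col → ∃ λ col′ → Proper P col′
    insert-edge {P} {e₀} {col} pe₀ bound proper = assign e₀ α recoloured , extend recoloured-proper misses-α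
      where
      free : ∀ v → Incident e₀ v → degree (delete e₀ P) v < K
      free v inc = subst (_≤ K) (degree-delete {P} {e₀} {v} pe₀ inc) (bound inc)
      a-free = missing-colour {v = inj₁ (left e₀)} proper (free (inj₁ (left e₀)) refl)
      b-free = missing-colour {v = inj₂ (right e₀)} proper (free (inj₂ (right e₀)) refl)
      α = proj₁ a-free
      open KempeChain proper (proj₂ a-free) (proj₂ b-free)
      misses-α : ∀ {v} → Incident e₀ v → Misses (delete e₀ P) recoloured v α
      misses-α {inj₁ _} refl = recoloured-misses-a
      misses-α {inj₂ _} refl = recoloured-misses-b

  proper-edge-colouring : ∀ {d} (P : BoolPred M) → (∀ v → degree P v ≤ suc d) →
                          ∃ λ (col : Fin M → Fin (suc d)) → Proper P col
  proper-edge-colouring {d} P bound = go (countFin M P) P refl bound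
    where
    go : ∀ n (P : BoolPred M) → countFin M P ≡ n → (∀ v → degree P v ≤ suc d) →
         ∃ λ (col : Fin M → Fin (suc d)) → Proper P col
    go zero P empty _ = (λ _ → zero) , λ pe _ _ _ _ → contradiction (subst (1 ≤_) empty (T⇒1≤countFin P _ pe)) λ ()
    go (suc n) P count bound with 1≤countFin⇒T P (subst (1 ≤_) (sym count) (s≤s z≤n))
    ... | e₀ , pe₀ = insert-edge pe₀ (λ {v} _ → bound v) (proj₂ smaller)
      where
      smaller = go n (delete e₀ P) (suc-injective (trans (sym (countFin-delete P e₀ pe₀)) count))
                  (λ v → ≤-trans (degree-mono (delete⊆ P e₀) v) (bound v))

colourClass : BoolPred k → (Fin k → ℕ) → ℕ → BoolPred k
colourClass S col c e = S e ∧ does (col e ≟ℕ c)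

module _ (G : Multigraph) where

  private
    n = nV G
    m = nE G

  src tgt : Fin m → Fin n
  src e = proj₁ (ends G e)
  tgt e = proj₂ (ends G e)

  degreeIn : BoolPred m → Fin n → ℕ
  degreeIn S x = countFin m (λ e → S e ∧ incidentB G e x)

  incident⁺ : ∀ {e x} → src e ≡ x ⊎ tgt e ≡ x → T (incidentB G e x)
  incident⁺ {e} {x} ends≡x = Equivalence.from T-∨ (Sum.map (does⁺ (src e ≟ᶠ x)) (does⁺ (tgt e ≟ᶠ x)) ends≡x)

  incident⁻ : ∀ {e x} → T (incidentB G e x) → src e ≡ x ⊎ tgt e ≡ x
  incident⁻ {e} {x} h = Sum.map (does⁻ (src e ≟ᶠ x)) (does⁻ (tgt e ≟ᶠ x)) (Equivalence.to T-∨ h)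

  degreeIn-ends : ∀ S x →
    degreeIn S x ≡ countFin m (λ e → S e ∧ does (src e ≟ᶠ x)) + countFin m (λ e → S e ∧ does (tgt e ≟ᶠ x))
  degreeIn-ends S x = trans (countFin-split _ (λ e → does (src e ≟ᶠ x)))
    (cong₂ _+_ (countFin-cong _ _ λ e → at-src (S e) (src e ≟ᶠ x) (tgt e ≟ᶠ x))
               (countFin-cong _ _ λ e → at-tgt (S e) (loopless G e) (src e ≟ᶠ x) (tgt e ≟ᶠ x)))
    where
    at-src : ∀ s {u w : Fin n} (u? : Dec (u ≡ x)) (w? : Dec (w ≡ x)) →
             (s ∧ (does u? ∨ does w?)) ∧ does u? ≡ s ∧ does u?
    at-src false _        _        = refl
    at-src true  (yes _)  _        = refl
    at-src true  (no _)   (yes _)  = refl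
    at-src true  (no _)   (no _)   = refl
    at-tgt : ∀ s {u w : Fin n} → u ≢ w → (u? : Dec (u ≡ x)) (w? : Dec (w ≡ x)) →
             (s ∧ (does u? ∨ does w?)) ∧ not (does u?) ≡ s ∧ does w?
    at-tgt false _    _         _         = refl
    at-tgt true  u≢w  (yes u≡x) (yes w≡x) = contradiction (trans u≡x (sym w≡x)) u≢w
    at-tgt true  _    (yes _)   (no _)    = refl
    at-tgt true  _    (no _)    (yes _)   = refl
    at-tgt true  _    (no _)    (no _)    = refl

  degreeIn-mono : ∀ {S S′} → S ⊆ S′ → ∀ x → degreeIn S x ≤ degreeIn S′ x
  degreeIn-mono {S} {S′} S⊆S′ x = countFin-mono (λ e → S e ∧ incidentB G e x) (λ e → S′ e ∧ incidentB G e x)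
    λ {e} h → let (se , inc) = Equivalence.to (T-∧ {S e}) h in Equivalence.from T-∧ (S⊆S′ se , inc)

  degreeIn-split : ∀ {F S} → F ⊆ S → ∀ x → degreeIn S x ≡ degreeIn F x + degreeIn (S ∖ F) x
  degreeIn-split {F} {S} F⊆S x = trans (countFin-split (λ e → S e ∧ incidentB G e x) F)
    (cong₂ _+_ (countFin-cong _ _ λ e → in-F e (S e) refl) (countFin-cong _ _ λ e → ∧-swap (S e) _ _))
    where
    in-F : ∀ e s → S e ≡ s → (s ∧ incidentB G e x) ∧ F e ≡ F e ∧ incidentB G e x
    in-F e true  _ = ∧-swap true (incidentB G e x) (F e)
    in-F e false se with F e in fe
    ... | false = refl
    ... | true  = contradiction (subst T se (F⊆S (subst T (sym fe) tt))) λ ()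

  -- Equal degrees at the two ends of every edge make each component of F regular.
  BoundedRegular : ℕ → BoolPred m → Set
  BoundedRegular r F = (∀ x → degreeIn F x ≤ r) × (∀ {e} → T (F e) → degreeIn F (src e) ≡ degreeIn F (tgt e))

  Covers : ℕ → BoolPred m → BoolPred m → Set
  Covers Δ S F = ∀ x → degreeIn S x ≡ Δ → 1 ≤ degreeIn F x

  BoundedRegular-cong : ∀ {r F F′} → (∀ e → F e ≡ F′ e) → BoundedRegular r F → BoundedRegular r F′
  BoundedRegular-cong {r} {F} {F′} F≗F′ (bounded , regular) =
    (λ x → subst (_≤ r) (same-degree x) (bounded x)) ,
    (λ {e} fe → trans (sym (same-degree _)) (trans (regular (subst T (sym (F≗F′ e)) fe)) (same-degree _)))
    where
    same-degree : ∀ x → degreeIn F x ≡ degreeIn F′ x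
    same-degree x = countFin-cong _ _ λ e → cong (_∧ incidentB G e x) (F≗F′ e)

  BoundedRegular-mono : ∀ {r r′ F} → r ≤ r′ → BoundedRegular r F → BoundedRegular r′ F
  BoundedRegular-mono r≤r′ (bounded , regular) = (λ x → ≤-trans (bounded x) r≤r′) , regular

  classes⇒IsBoundedRegular : ∀ {k r} (f : Colouring G k) → (∀ c → BoundedRegular r (λ e → does (f e ≟ᶠ c))) →
                             IsBoundedRegular G r f
  classes⇒IsBoundedRegular f regular c = proj₁ (regular c) , connected
    where
    connected : ∀ u v → Connected G f c u v → colDeg G f c u ≡ colDeg G f c v
    connected u .u here = refl
    connected u v (step {w = w} e fe joins rest) = trans (along joins) (connected w v rest)
      where
      along : Joins G e u w → colDeg G f c u ≡ colDeg G f c w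
      along (inj₁ (refl , refl)) = proj₂ (regular c) (does⁺ (f e ≟ᶠ c) fe)
      along (inj₂ (refl , refl)) = sym (proj₂ (regular c) (does⁺ (f e ≟ᶠ c) fe))

  Arc : Set
  Arc = Fin (m + m)

  forward backward : Fin m → Arc
  forward e  = e ↑ˡ m
  backward e = m ↑ʳ e

  edgeOf : Arc → Fin m
  edgeOf a = reduce (splitAt m a)

  orient : Fin m ⊎ Fin m → Fin n × Fin n
  orient (inj₁ e) = ends G e
  orient (inj₂ e) = swap (ends G e)

  tail head : Arc → Fin n
  tail a = proj₁ (orient (splitAt m a))
  head a = proj₂ (orient (splitAt m a))

  Touches : Arc → Fin n → Set
  Touches a x = tail a ≡ x ⊎ head a ≡ x

  arc-cases : ∀ a → (a ≡ forward (edgeOf a) × tail a ≡ src (edgeOf a) × head a ≡ tgt (edgeOf a))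
                  ⊎ (a ≡ backward (edgeOf a) × tail a ≡ tgt (edgeOf a) × head a ≡ src (edgeOf a))
  arc-cases a with splitAt m a in eq
  ... | inj₁ e = inj₁ (trans (sym (join-splitAt m m a)) (cong (join m m) eq) , refl , refl)
  ... | inj₂ e = inj₂ (trans (sym (join-splitAt m m a)) (cong (join m m) eq) , refl , refl)

  edgeOf-forward : ∀ e → edgeOf (forward e) ≡ e
  edgeOf-forward e = cong reduce (splitAt-↑ˡ m e m)

  edgeOf-backward : ∀ e → edgeOf (backward e) ≡ e
  edgeOf-backward e = cong reduce (splitAt-↑ʳ m m e)

  tail≢head : ∀ a → tail a ≢ head a
  tail≢head a with arc-cases a
  ... | inj₁ (_ , t , h) = λ t≡h → loopless G (edgeOf a) (trans (sym t) (trans t≡h h))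
  ... | inj₂ (_ , t , h) = λ t≡h → loopless G (edgeOf a) (trans (sym h) (trans (sym t≡h) t))

  touches-incident : ∀ {a x} → Touches a x → T (incidentB G (edgeOf a) x)
  touches-incident {a} touches with arc-cases a | touches
  ... | inj₁ (_ , t , _) | inj₁ t≡x = incident⁺ (inj₁ (trans (sym t) t≡x))
  ... | inj₁ (_ , _ , h) | inj₂ h≡x = incident⁺ (inj₂ (trans (sym h) h≡x))
  ... | inj₂ (_ , t , _) | inj₁ t≡x = incident⁺ (inj₂ (trans (sym t) t≡x))
  ... | inj₂ (_ , _ , h) | inj₂ h≡x = incident⁺ (inj₁ (trans (sym h) h≡x))

  incident-touches : ∀ {a x} → T (incidentB G (edgeOf a) x) → Touches a x
  incident-touches {a} inc with arc-cases a | incident⁻ inc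
  ... | inj₁ (_ , t , _) | inj₁ s≡x = inj₁ (trans t s≡x)
  ... | inj₁ (_ , _ , h) | inj₂ t≡x = inj₂ (trans h t≡x)
  ... | inj₂ (_ , _ , h) | inj₁ s≡x = inj₂ (trans h s≡x)
  ... | inj₂ (_ , t , _) | inj₂ t≡x = inj₁ (trans t t≡x)

  same-edge⇒reversed : ∀ {a b} → edgeOf a ≡ edgeOf b → a ≢ b → tail b ≡ head a × head b ≡ tail a
  same-edge⇒reversed {a} {b} same a≢b with arc-cases a | arc-cases b
  ... | inj₁ (a≡ , _) | inj₁ (b≡ , _) = contradiction (trans a≡ (trans (cong forward same) (sym b≡))) a≢b
  ... | inj₂ (a≡ , _) | inj₂ (b≡ , _) = contradiction (trans a≡ (trans (cong backward same) (sym b≡))) a≢b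
  ... | inj₁ (_ , ta , ha) | inj₂ (_ , tb , hb) =
        trans tb (trans (cong tgt (sym same)) (sym ha)) , trans hb (trans (cong src (sym same)) (sym ta))
  ... | inj₂ (_ , ta , ha) | inj₁ (_ , tb , hb) =
        trans tb (trans (cong src (sym same)) (sym ha)) , trans hb (trans (cong tgt (sym same)) (sym ta))

  arcs-at : ∀ (end : Fin n × Fin n → Fin n) (S : BoolPred m) x →
    countFin (m + m) (λ a → S (edgeOf a) ∧ does (end (orient (splitAt m a)) ≟ᶠ x))
      ≡ countFin m (λ e → S e ∧ does (end (ends G e) ≟ᶠ x)) + countFin m (λ e → S e ∧ does (end (swap (ends G e)) ≟ᶠ x))
  arcs-at end S x = trans (countFin-++ m m (at ∘ splitAt m)) (cong₂ _+_
    (countFin-cong (λ e → at (splitAt m (e ↑ˡ m))) (at ∘ inj₁) λ e → cong at (splitAt-↑ˡ m e m))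
    (countFin-cong (λ e → at (splitAt m (m ↑ʳ e))) (at ∘ inj₂) λ e → cong at (splitAt-↑ʳ m m e)))
    where
    at : Fin m ⊎ Fin m → Bool
    at s = S (reduce s) ∧ does (end (orient s) ≟ᶠ x)

  arcs-at-tail : ∀ S x → countFin (m + m) (λ a → S (edgeOf a) ∧ does (tail a ≟ᶠ x)) ≡ degreeIn S x
  arcs-at-tail S x = trans (arcs-at proj₁ S x) (sym (degreeIn-ends S x))

  arcs-at-head : ∀ S x → countFin (m + m) (λ a → S (edgeOf a) ∧ does (head a ≟ᶠ x)) ≡ degreeIn S x
  arcs-at-head S x = trans (arcs-at proj₂ S x)
    (trans (+-comm (countFin m (λ e → S e ∧ does (tgt e ≟ᶠ x))) _) (sym (degreeIn-ends S x)))

  module Selection {Matched : Arc → Set} (matched? : ∀ a → Dec (Matched a))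
    (tail-unique : ∀ {a b} → Matched a → Matched b → tail a ≡ tail b → a ≡ b)
    (head-unique : ∀ {a b} → Matched a → Matched b → head a ≡ head b → a ≡ b) where

    matchedAt : (Arc → Fin n) → Fin n → Maybe Arc
    matchedAt end x with any? (λ a → matched? a ×-dec end a ≟ᶠ x)
    ... | yes (a , _) = just a
    ... | no _        = nothing

    matchedAt-just : ∀ {end x a} → matchedAt end x ≡ just a → Matched a × end a ≡ x
    matchedAt-just {end} {x} h with any? (λ a → matched? a ×-dec end a ≟ᶠ x)
    matchedAt-just refl | yes (_ , found) = found

    matchedAt-unique : ∀ {end x a} → (∀ {a b} → Matched a → Matched b → end a ≡ end b → a ≡ b) →
                       Matched a → end a ≡ x → matchedAt end x ≡ just a
    matchedAt-unique {end} {x} unique ma end≡x with any? (λ a → matched? a ×-dec end a ≟ᶠ x)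
    ... | yes (_ , mb , end≡x′) = cong just (unique mb ma (trans end≡x′ (sym end≡x)))
    ... | no none               = contradiction (_ , ma , end≡x) none

    leaving entering : Fin n → Maybe Arc
    leaving  = matchedAt tail
    entering = matchedAt head

    pred : Fin n → Maybe (Fin n)
    pred x = Maybe.map tail (entering x)

    pred-arc : ∀ {a} → Matched a → pred (head a) ≡ just (tail a)
    pred-arc ma rewrite matchedAt-unique head-unique ma refl = refl

    pred-just : ∀ {x y} → pred x ≡ just y → ∃ λ a → Matched a × head a ≡ x × tail a ≡ y
    pred-just {x} h with entering x in eq
    pred-just refl | just a = let (ma , ha) = matchedAt-just eq in a , ma , ha , refl

    pred-injective : ∀ {x x′ y} → pred x ≡ just y → pred x′ ≡ just y → x ≡ x′
    pred-injective h h′ with pred-just h | pred-just h′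
    ... | a , ma , refl , ta | a′ , ma′ , refl , ta′ = cong head (tail-unique ma ma′ (trans ta (sym ta′)))

    open PartialInjection id id pred pred-injective

    -- pred walks backwards along the matched paths, so an arc is selected if it lies on a cycle or its tail is at
    -- odd distance from the start of its path: every second arc of a path, beginning with the second.
    Selected : Arc → Set
    Selected a = Matched a × T (alternating (tail a))

    selected? : ∀ a → Dec (Selected a)
    selected? a = matched? a ×-dec T? (alternating (tail a))

    F : BoolPred m
    F e = does (selected? (forward e)) ∨ does (selected? (backward e))

    F⁻ : ∀ {e} → T (F e) → ∃ λ a → Selected a × edgeOf a ≡ e
    F⁻ {e} h with Equivalence.to T-∨ h
    ... | inj₁ fwd = forward e  , does⁻ (selected? _) fwd , edgeOf-forward e
    ... | inj₂ bwd = backward e , does⁻ (selected? _) bwd , edgeOf-backward e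

    F⁺ : ∀ {a} → Selected a → T (F (edgeOf a))
    F⁺ {a} sel with arc-cases a
    ... | inj₁ (a≡ , _) = Equivalence.from T-∨ (inj₁ (does⁺ (selected? _) (subst Selected a≡ sel)))
    ... | inj₂ (a≡ , _) = Equivalence.from T-∨ (inj₂ (does⁺ (selected? _) (subst Selected a≡ sel)))

    F-at⁻ : ∀ {e x} → T (F e ∧ incidentB G e x) → ∃ λ a → Selected a × edgeOf a ≡ e × Touches a x
    F-at⁻ {e} {x} h with Equivalence.to T-∧ h
    ... | fe , inc with F⁻ fe
    ...   | a , sel , a∈e = a , sel , a∈e , incident-touches (subst (λ e → T (incidentB G e x)) (sym a∈e) inc)

    F-at⁺ : ∀ {a x} → Selected a → Touches a x → T (F (edgeOf a) ∧ incidentB G (edgeOf a) x)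
    F-at⁺ sel touches = Equivalence.from T-∧ (F⁺ sel , touches-incident touches)

    1≤degreeF : ∀ {a x} → Selected a → Touches a x → 1 ≤ degreeIn F x
    1≤degreeF {a} {x} sel touches = T⇒1≤countFin (λ e → F e ∧ incidentB G e x) (edgeOf a) (F-at⁺ sel touches)

    degreeF-one : ∀ {a x} → Selected a → Touches a x →
                  (∀ {b} → Selected b → Touches b x → edgeOf b ≡ edgeOf a) → degreeIn F x ≡ 1
    degreeF-one {a} {x} sel touches only-a = ≤-antisym
      (countFin≤1 _ (edgeOf a) λ h → let (b , selb , b∈e , tb) = F-at⁻ h in trans (sym b∈e) (only-a selb tb))
      (1≤degreeF sel touches)

    degreeF-two : ∀ {a b x} → Selected a → Touches a x → Selected b → Touches b x → edgeOf a ≢ edgeOf b →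
                  (∀ {c} → Selected c → Touches c x → edgeOf c ≡ edgeOf a ⊎ edgeOf c ≡ edgeOf b) →
                  degreeIn F x ≡ 2
    degreeF-two {a} {b} {x} sela ta selb tb a≢b only = ≤-antisym
      (countFin≤2 _ (just (edgeOf a)) (just (edgeOf b)) λ h →
        let (c , selc , c∈e , tc) = F-at⁻ h
            edge≡ = λ {d} (c≡d : edgeOf c ≡ edgeOf d) → cong just (trans (sym c≡d) c∈e)
        in Sum.map edge≡ edge≡ (only selc tc))
      (2≤countFin (λ e → F e ∧ incidentB G e x) a≢b (F-at⁺ sela ta) (F-at⁺ selb tb))

    degreeF≤2 : ∀ x → degreeIn F x ≤ 2
    degreeF≤2 x = countFin≤2 _ (Maybe.map edgeOf (leaving x)) (Maybe.map edgeOf (entering x)) λ h →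
      let (a , (ma , _) , a∈e , ta) = F-at⁻ h
      in Sum.map (candidate tail-unique ma a∈e) (candidate head-unique ma a∈e) ta
      where
      candidate : ∀ {end a e} → (∀ {a b} → Matched a → Matched b → end a ≡ end b → a ≡ b) →
                  Matched a → edgeOf a ≡ e → end a ≡ x → Maybe.map edgeOf (matchedAt end x) ≡ just e
      candidate unique ma a∈e end≡x rewrite matchedAt-unique unique ma end≡x = cong just a∈e

    degreeF-through : ∀ {o i x} → Selected o → tail o ≡ x → Selected i → head i ≡ x →
                      (edgeOf o ≡ edgeOf i → degreeIn F x ≡ 1) × (edgeOf o ≢ edgeOf i → degreeIn F x ≡ 2)
    degreeF-through {o} {i} selo to seli hi = one , two
      where
      only : ∀ {c} → Selected c → Touches c _ → c ≡ o ⊎ c ≡ i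
      only (mc , _) (inj₁ tc) = inj₁ (tail-unique mc (proj₁ selo) (trans tc (sym to)))
      only (mc , _) (inj₂ hc) = inj₂ (head-unique mc (proj₁ seli) (trans hc (sym hi)))
      one : edgeOf o ≡ edgeOf i → degreeIn F _ ≡ 1
      one o∼i = degreeF-one selo (inj₁ to) λ selc tc →
        [ cong edgeOf , (λ c≡i → trans (cong edgeOf c≡i) (sym o∼i)) ] (only selc tc)
      two : edgeOf o ≢ edgeOf i → degreeIn F _ ≡ 2
      two o≁i = degreeF-two selo (inj₁ to) seli (inj₂ hi) o≁i λ selc tc →
        Sum.map (cong edgeOf) (cong edgeOf) (only selc tc)

    -- The in-arc i of tail a and the out-arc o of head a either both reverse a, or neither does.
    cycle-arc-regular : ∀ {a i o} → Selected a → Selected i → head i ≡ tail a → Selected o → tail o ≡ head a →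
                        degreeIn F (tail a) ≡ degreeIn F (head a)
    cycle-arc-regular {a} {i} {o} sel seli hi selo to = go (edgeOf a ≟ᶠ edgeOf i)
      where
      at-t = degreeF-through sel refl seli hi
      at-h = degreeF-through selo to sel refl
      a≢i : a ≢ i
      a≢i refl = tail≢head a (sym hi)
      a≢o : a ≢ o
      a≢o refl = tail≢head a to
      go : Dec (edgeOf a ≡ edgeOf i) → degreeIn F (tail a) ≡ degreeIn F (head a)
      go (yes a∼i) = trans (proj₁ at-t a∼i) (sym (proj₁ at-h o∼a))
        where
        o∼a : edgeOf o ≡ edgeOf a
        o∼a = trans (cong edgeOf (tail-unique mo mi (trans to (sym (proj₁ (same-edge⇒reversed a∼i a≢i)))))) (sym a∼i)
          where mo = proj₁ selo ; mi = proj₁ seli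
      go (no a≁i) = trans (proj₂ at-t a≁i) (sym (proj₂ at-h o≁a))
        where
        o≁a : edgeOf o ≢ edgeOf a
        o≁a o∼a = a≁i (trans (sym o∼a) (cong edgeOf (head-unique (proj₁ selo) (proj₁ seli)
                         (trans (proj₂ (same-edge⇒reversed (sym o∼a) a≢o)) (sym hi)))))

    arc-regular : ∀ {a} → Selected a → degreeIn F (tail a) ≡ degreeIn F (head a)
    arc-regular {a} sel@(ma , alt-t) with cyclic? (head a)
    ... | no acyclic-h = trans (degreeF-one sel (inj₁ refl) only-at-t) (sym (degreeF-one sel (inj₂ refl) only-at-h))
      where
      acyclic-t : ¬ Cyclic (tail a)
      acyclic-t cyc = acyclic-h (cyclic-step⁻ (pred-arc ma) cyc)
      only-at-t : ∀ {b} → Selected b → Touches b (tail a) → edgeOf b ≡ edgeOf a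
      only-at-t (mb , _)     (inj₁ tb) = cong edgeOf (tail-unique mb ma tb)
      only-at-t (mb , alt-b) (inj₂ hb) =
        contradiction alt-b (alternating-step⁺ (subst (λ x → pred x ≡ _) hb (pred-arc mb)) acyclic-t alt-t)
      only-at-h : ∀ {b} → Selected b → Touches b (head a) → edgeOf b ≡ edgeOf a
      only-at-h (mb , _)     (inj₂ hb) = cong edgeOf (head-unique mb ma hb)
      only-at-h (mb , alt-b) (inj₁ tb) =
        contradiction alt-t (alternating-step⁺ (pred-arc ma) acyclic-h (subst (T ∘ alternating) tb alt-b))
    ... | yes cyclic-h with cyclic⇒stepped (cyclic-step (pred-arc ma) cyclic-h) | cyclic⇒entered cyclic-h
    ...   | y , t↦y | u , u↦h with pred-just t↦y | pred-just u↦h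
    ...     | i , mi , hi , ti | o , mo , _ , to =
      cycle-arc-regular sel (mi , subst (T ∘ alternating) (sym ti) (cyclic⇒alternating (cyclic-step t↦y cyclic-t))) hi
                            (mo , subst (T ∘ alternating) (sym to) (cyclic⇒alternating cyclic-h)) to
      where
      cyclic-t : Cyclic (tail a)
      cyclic-t = cyclic-step (pred-arc ma) cyclic-h

    covered : ∀ {x} → (∃ λ o → Matched o × tail o ≡ x) → (∃ λ i → Matched i × head i ≡ x) →
              1 ≤ degreeIn F x
    covered {x} (o , mo , to) (i , mi , hi) with T? (alternating x)
    ... | yes alt-x = 1≤degreeF (mo , subst (T ∘ alternating) (sym to) alt-x) (inj₁ to)
    ... | no ¬alt-x = 1≤degreeF (mi , alternating-step⁻ x↦ti acyclic ¬alt-x) (inj₂ hi)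
      where
      acyclic : ¬ Cyclic x
      acyclic cyc = ¬alt-x (cyclic⇒alternating cyc)
      x↦ti : pred x ≡ just (tail i)
      x↦ti = subst (λ x → pred x ≡ _) hi (pred-arc mi)

    F-regular : ∀ {e} → T (F e) → degreeIn F (src e) ≡ degreeIn F (tgt e)
    F-regular fe with F⁻ fe
    ... | a , sel , refl with arc-cases a
    ...   | inj₁ (_ , t , h) = trans (cong (degreeIn F) (sym t)) (trans (arc-regular sel) (cong (degreeIn F) h))
    ...   | inj₂ (_ , t , h) = sym (trans (cong (degreeIn F) (sym t)) (trans (arc-regular sel) (cong (degreeIn F) h)))

  bounded-regular-cover : ∀ (S : BoolPred m) D → (∀ x → degreeIn S x ≤ suc D) →
    ∃ λ F → F ⊆ S × BoundedRegular 2 F × Covers (suc D) S F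
  bounded-regular-cover S D bound = F , F⊆S , (degreeF≤2 , F-regular) , cover
    where
    open Bipartite tail head

    P : BoolPred (m + m)
    P a = S (edgeOf a)

    arc-degree : ∀ v → degree P v ≡ degreeIn S (reduce v)
    arc-degree (inj₁ x) = arcs-at-tail S x
    arc-degree (inj₂ x) = arcs-at-head S x

    coloured = proper-edge-colouring P (λ v → subst (_≤ suc D) (sym (arc-degree v)) (bound _))
    col = proj₁ coloured
    proper = proj₂ coloured

    Matched : Arc → Set
    Matched a = T (P a) × col a ≡ zero

    matched? : ∀ a → Dec (Matched a)
    matched? a = T? (P a) ×-dec col a ≟ᶠ zero

    open Selection matched?
      (λ (pa , ca) (pb , cb) t → proper {inj₁ _} pa pb t refl (trans ca (sym cb)))
      (λ (pa , ca) (pb , cb) h → proper {inj₂ _} pa pb h refl (trans ca (sym cb)))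

    F⊆S : F ⊆ S
    F⊆S fe = let (a , ((pa , _) , _) , a∈e) = F⁻ fe in subst (T ∘ S) a∈e pa

    cover : Covers (suc D) S F
    cover x full with present-colour {v = inj₁ x} proper (trans (arc-degree (inj₁ x)) full) zero
                    | present-colour {v = inj₂ x} proper (trans (arc-degree (inj₂ x)) full) zero
    ... | o , po , to , co | i , pi , hi , ci = covered (o , (po , co) , to) (i , (pi , ci) , hi)

  Decomposition : ℕ → BoolPred m → Set
  Decomposition D S = ∃ λ (col : Fin m → ℕ) →
    (∀ {e} → T (S e) → col e < D) × (∀ c → BoundedRegular 2 (colourClass S col c))

  edgeless-decomposition : ∀ {S} → (∀ x → degreeIn S x ≤ 0) → Decomposition 0 S
  edgeless-decomposition {S} bound = (λ _ → 0) , (λ se → contradiction se no-edge) , λ c →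
    (λ x → ≤-trans (degreeIn-mono (proj₁ ∘ Equivalence.to T-∧) x) (≤-trans (bound x) z≤n)) ,
    (λ ce → contradiction (proj₁ (Equivalence.to T-∧ ce)) no-edge)
    where
    no-edge : ∀ {e} → ¬ T (S e)
    no-edge {e} se =
      1+n≰n (≤-trans (T⇒1≤countFin _ e (Equivalence.from T-∧ (se , incident⁺ (inj₁ refl)))) (bound (src e)))

  remove-cover : ∀ {S F D} → F ⊆ S → Covers (suc D) S F → (∀ x → degreeIn S x ≤ suc D) →
                 ∀ x → degreeIn (S ∖ F) x ≤ D
  remove-cover {S} {F} {D} F⊆S covers bound x with degreeIn S x ≟ℕ suc D
  ... | yes full = +-cancelˡ-≤ 1 _ _ (begin
    1 + degreeIn (S ∖ F) x            ≤⟨ +-monoˡ-≤ _ (covers x full) ⟩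
    degreeIn F x + degreeIn (S ∖ F) x ≡⟨ degreeIn-split F⊆S x ⟨
    degreeIn S x                      ≤⟨ bound x ⟩
    suc D                             ∎)
    where open ≤-Reasoning
  ... | no ¬full = ≤-pred (begin-strict
    degreeIn (S ∖ F) x                ≤⟨ m≤n+m _ _ ⟩
    degreeIn F x + degreeIn (S ∖ F) x ≡⟨ degreeIn-split F⊆S x ⟨
    degreeIn S x                      <⟨ ≤∧≢⇒< (bound x) ¬full ⟩
    suc D                             ∎)
    where open ≤-Reasoning

  add-class : ∀ {S F D} → F ⊆ S → BoundedRegular 2 F → Decomposition D (S ∖ F) → Decomposition (suc D) S
  add-class {S} {F} {D} F⊆S F-regular (col , col<D , classes) = colour , colour<1+D , classes′
    where
    colour : Fin m → ℕ
    colour e = if F e then D else col e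

    unused-colour : ∀ {e} → T (S e) → F e ≡ false → col e < D
    unused-colour {e} se fe = col<D (Equivalence.from T-∧ (se , subst (T ∘ not) (sym fe) tt))

    colour<1+D : ∀ {e} → T (S e) → colour e < suc D
    colour<1+D {e} se with F e in fe
    ... | true  = ≤-refl
    ... | false = m≤n⇒m≤1+n (unused-colour se fe)

    top-class : ∀ e → F e ≡ colourClass S colour D e
    top-class e with F e in fe | S e in se
    ... | true  | true  = sym (dec-true (D ≟ℕ D) refl)
    ... | true  | false = contradiction (subst T se (F⊆S (subst T (sym fe) tt))) λ ()
    ... | false | false = refl
    ... | false | true  = sym (dec-false (col e ≟ℕ D) (<⇒≢ (unused-colour (subst T (sym se) tt) fe)))

    lower-class : ∀ c → c ≢ D → ∀ e → colourClass (S ∖ F) col c e ≡ colourClass S colour c e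
    lower-class c c≢D e with F e | S e
    ... | true  | true  = sym (dec-false (D ≟ℕ c) (c≢D ∘ sym))
    ... | true  | false = refl
    ... | false | true  = refl
    ... | false | false = refl

    classes′ : ∀ c → BoundedRegular 2 (colourClass S colour c)
    classes′ c with c ≟ℕ D
    ... | yes refl = BoundedRegular-cong top-class F-regular
    ... | no c≢D   = BoundedRegular-cong (lower-class c c≢D) (classes c)

  decompose : ∀ D S → (∀ x → degreeIn S x ≤ D) → Decomposition D S
  decompose zero    S bound = edgeless-decomposition bound
  decompose (suc D) S bound = peel (bounded-regular-cover S D bound)
    where
    peel : (∃ λ F → F ⊆ S × BoundedRegular 2 F × Covers (suc D) S F) → Decomposition (suc D) S
    peel (F , F⊆S , F-regular , covers) =
      add-class F⊆S F-regular (decompose D (S ∖ F) (remove-cover F⊆S covers bound))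

∈⇒≤max : ∀ {xs : List ℕ} {x} → x ∈ xs → x ≤ foldr _⊔_ 0 xs
∈⇒≤max (here refl) = m≤m⊔n _ _
∈⇒≤max {y ∷ _} (there x∈xs) = m≤n⇒m≤o⊔n y (∈⇒≤max x∈xs)

deg≤maxDeg : ∀ G x → deg G x ≤ maxDeg G
deg≤maxDeg G x = ∈⇒≤max (∈-map⁺ (deg G) (∈-allFin x))

corollary2p3 : (G : Multigraph) (r : ℕ) → 2 ≤ r →
    Σ ℕ (λ k → k ≤ maxDeg G × Σ (Colouring G k) (λ f → IsBoundedRegular G r f))
corollary2p3 G r 2≤r = maxDeg G , ≤-refl , f , classes⇒IsBoundedRegular G f λ c →
  BoundedRegular-mono G 2≤r (BoundedRegular-cong G (same-class c) (classes (toℕ c)))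
  where
  decomposition = decompose G (maxDeg G) (λ _ → true) (deg≤maxDeg G)
  col = proj₁ decomposition
  classes = proj₂ (proj₂ decomposition)
  col< : ∀ e → col e < maxDeg G
  col< e = proj₁ (proj₂ decomposition) tt
  f : Colouring G (maxDeg G)
  f e = fromℕ< (col< e)
  same-class : ∀ c e → colourClass (λ _ → true) col (toℕ c) e ≡ does (f e ≟ᶠ c)
  same-class c e = does-⇔ (mk⇔ (λ col≡c → toℕ-injective (trans (toℕ-fromℕ< (col< e)) col≡c))
                                (λ f≡c → trans (sym (toℕ-fromℕ< (col< e))) (cong toℕ f≡c)))
                          (col e ≟ℕ toℕ c) (f e ≟ᶠ c)
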